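{- Let $m,n,a,b\ge 2$ be integers such that $a$ and $b$ both divide $\gcd(m,n)$. (i) If $b>a$, then $$\binom{\frac{m+n}{a}}{\frac{m}{a},\frac{n}{a}}\Big/ \binom{\frac{m+n}{b}}{\frac{m}{b},\frac{n}{b}}\geq \Big(1+\frac{m}{n}\Big)^{n(\frac{1}{a}-\frac{1}{b})}\Big(1+\frac{a}{b}\frac{n}{m}\Big)^{m(\frac{1}{a}-\frac{1}{b})},$$ and consequently $\binom{\frac{m+n}{a}}{\frac{m}{a},\frac{n}{a}}> \binom{\frac{m+n}{b}}{\frac{m}{b},\frac{n}{b}}$. (ii) If $b\ge 2a$, then $$a \binom{\frac{m+n}{a}}{\frac{m}{a},\frac{n}{a}}> \max\{m,n\}\binom{\frac{m+n}{b}}{\frac{m}{b},\frac{n}{b}}.$$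
   Context: For nonnegative integers $x,y$, $\binom{x+y}{x,y}$ denotes the multinomial coefficient $\frac{(x+y)!}{x!\,y!}$. -}

module Defs where

open import Data.Nat using (ℕ; zero; suc; _+_; _*_; _!; _/_; NonZero)
open import Data.Nat.Properties using (_!*_!≢0; m*n≢0)
open import Data.Integer using (+_)
import Data.Rational as ℚ
open ℚ using (ℚ; 1ℚ)

multinom : ℕ → ℕ → ℕ
multinom x y = (x + y) ! / (x ! * y !)
  where instance _ = x !* y !≢0

_^ℚ_ : ℚ → ℕ → ℚ
q ^ℚ zero = 1ℚ
q ^ℚ suc k = q ℚ.* (q ^ℚ k)

onePlusFrac : (m n : ℕ) .{{_ : NonZero n}} → ℚ
onePlusFrac m n = 1ℚ ℚ.+ ((+ m) ℚ./ n)

onePlusFrac2 : (a b n m : ℕ) .{{_ : NonZero b}} .{{_ : NonZero m}} → ℚ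
onePlusFrac2 a b n m = 1ℚ ℚ.+ ((+ (a * n)) ℚ./ (b * m))
  where instance _ = m*n≢0 b m

ℕtoℚ : ℕ → ℚ
ℕtoℚ k = (+ k) ℚ./ 1

-- Put P = m/b, Q = n/b, p = m/a, q = n/a. Raising the first argument of multinom x y by one multiplies
-- it by (x + 1 + y)/(x + 1), which is at least (p + y)/p as long as x < p; climbing from (P, Q) to (p, Q)
-- and then to (p, q) gives multinom p q ≥ multinom P Q · ((p + Q)/p)^(p − P) · ((q + p)/q)^(q − Q), and
-- these two ratios are exactly 1 + (a/b)(n/m) and 1 + m/n.
-- For (ii), induction on Q gives 2P · multinom P Q < multinom (2P) (2Q); for x ≥ 1 and q ≥ 2 the ratio
-- multinom (x + 1) q / multinom x q is at least (x + 1)/x, so the factor 2P can be raised to any p ≥ 2P.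
module Submission where

open import Defs
open import Data.Nat using (ℕ; _≤_; _<_; _*_; _/_; _∸_; _⊔_; NonZero)
open import Data.Nat.Divisibility using (_∣_)
open import Data.Nat.GCD using (gcd)
open import Data.Product using (_×_)
import Data.Rational as ℚ

open import Data.Nat
open import Data.Nat.Properties
open import Data.Nat.Divisibility using (∣-trans)
open import Data.Nat.DivMod using (m/n*n≡m)
open import Data.Nat.GCD using (gcd[m,n]∣m; gcd[m,n]∣n)
open import Data.Nat.Combinatorics.Specification using ([n∸k]!k!∣n!)
open import Data.Nat.Solver using (module +-*-Solver)
open import Algebra.Properties.CommutativeSemigroup *-commutativeSemigroup
  using (interchange; x∙yz≈y∙xz; x∙yz≈xz∙y; xy∙z≈xz∙y; xy∙z≈y∙xz)
open import Data.Integer using (+_; +≤+)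
import Data.Integer as ℤ
open import Data.Integer.Properties using (pos-+; pos-*)
open ℚ using (ℚ; toℚᵘ)
open import Data.Rational.Properties using (toℚᵘ-fromℚᵘ; toℚᵘ-homo-+; toℚᵘ-homo-*; toℚᵘ-cancel-≤)
open import Data.Rational.Unnormalised as ℚᵘ using (ℚᵘ; mkℚᵘ; ↥_; ↧ₙ_; *≤*)
import Data.Rational.Unnormalised.Properties as ℚᵘₚ
open import Data.Product using (_,_)
open import Relation.Binary.PropositionalEquality
open import Relation.Nullary using (contradiction)
open +-*-Solver

multinom*!≡! : ∀ x y → multinom x y * (x ! * y !) ≡ (x + y) !
multinom*!≡! x y = m/n*n≡m {{x !* y !≢0}} x!*y!∣[x+y]!
  where
  x!*y!∣[x+y]! : x ! * y ! ∣ (x + y) !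
  x!*y!∣[x+y]! = subst (λ z → z ! * y ! ∣ (x + y) !) (m+n∸n≡m x y) ([n∸k]!k!∣n! (m≤n+m y x))

multinom-comm : ∀ x y → multinom x y ≡ multinom y x
multinom-comm x y = *-cancelʳ-≡ _ _ (x ! * y !) {{x !* y !≢0}} (begin
  multinom x y * (x ! * y !) ≡⟨ multinom*!≡! x y ⟩
  (x + y) !                  ≡⟨ cong _! (+-comm x y) ⟩
  (y + x) !                  ≡⟨ multinom*!≡! y x ⟨
  multinom y x * (y ! * x !) ≡⟨ cong (multinom y x *_) (*-comm (y !) (x !)) ⟩
  multinom y x * (x ! * y !) ∎)
  where open ≡-Reasoning

multinom-sucˡ : ∀ x y → suc x * multinom (suc x) y ≡ suc (x + y) * multinom x y
multinom-sucˡ x y = *-cancelʳ-≡ _ _ (x ! * y !) {{x !* y !≢0}} (begin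
  suc x * multinom (suc x) y * (x ! * y !)
    ≡⟨ solve 4 (λ s f u v → s :* f :* (u :* v) := f :* (s :* u :* v)) refl (suc x) (multinom (suc x) y) (x !) (y !) ⟩
  multinom (suc x) y * (suc x ! * y !) ≡⟨ multinom*!≡! (suc x) y ⟩
  suc (x + y) * (x + y) !              ≡⟨ cong (suc (x + y) *_) (multinom*!≡! x y) ⟨
  suc (x + y) * (multinom x y * (x ! * y !)) ≡⟨ *-assoc (suc (x + y)) (multinom x y) _ ⟨
  suc (x + y) * multinom x y * (x ! * y !) ∎)
  where open ≡-Reasoning

multinom-sucʳ : ∀ x y → suc y * multinom x (suc y) ≡ suc (x + y) * multinom x y
multinom-sucʳ x y = begin
  suc y * multinom x (suc y) ≡⟨ cong (suc y *_) (multinom-comm x (suc y)) ⟩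
  suc y * multinom (suc y) x ≡⟨ multinom-sucˡ y x ⟩
  suc (y + x) * multinom y x ≡⟨ cong₂ (λ s f → suc s * f) (+-comm y x) (multinom-comm y x) ⟩
  suc (x + y) * multinom x y ∎
  where open ≡-Reasoning

multinom>0 : ∀ x y → multinom x y > 0
multinom>0 x y = n≢0⇒n>0 λ eq →
  ≢-nonZero⁻¹ ((x + y) !) {{(x + y) !≢0}} (trans (sym (multinom*!≡! x y)) (cong (_* (x ! * y !)) eq))

multinom-≤-sucˡ : ∀ x y → multinom x y ≤ multinom (suc x) y
multinom-≤-sucˡ x y = *-cancelˡ-≤ (suc x) (begin
  suc x * multinom x y       ≤⟨ *-monoˡ-≤ (multinom x y) (s≤s (m≤m+n x y)) ⟩
  suc (x + y) * multinom x y ≡⟨ multinom-sucˡ x y ⟨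
  suc x * multinom (suc x) y ∎)
  where open ≤-Reasoning

multinom-<-sucʳ : ∀ {x} y → x > 0 → multinom x y < multinom x (suc y)
multinom-<-sucʳ {x} y x>0 = *-cancelˡ-< (suc y) _ _ (begin-strict
  suc y * multinom x y       <⟨ *-monoˡ-< (multinom x y) {{>-nonZero (multinom>0 x y)}} (s≤s (+-monoˡ-≤ y x>0)) ⟩
  suc (x + y) * multinom x y ≡⟨ multinom-sucʳ x y ⟨
  suc y * multinom x (suc y) ∎)
  where open ≤-Reasoning

multinom-monoˡ-≤ : ∀ {x x′} y → x ≤ x′ → multinom x y ≤ multinom x′ y
multinom-monoˡ-≤ y x≤x′ = go (≤⇒≤′ x≤x′)
  where
  go : ∀ {x x′} → x ≤′ x′ → multinom x y ≤ multinom x′ y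
  go ≤′-refl                   = ≤-refl
  go {x′ = suc x′} (≤′-step x≤′x′) = ≤-trans (go x≤′x′) (multinom-≤-sucˡ x′ y)

multinom-monoʳ-≤ : ∀ x {y y′} → y ≤ y′ → multinom x y ≤ multinom x y′
multinom-monoʳ-≤ x {y} {y′} y≤y′ =
  subst₂ _≤_ (multinom-comm y x) (multinom-comm y′ x) (multinom-monoˡ-≤ x y≤y′)

multinom-mono-≤ : ∀ {x x′ y y′} → x ≤ x′ → y ≤ y′ → multinom x y ≤ multinom x′ y′
multinom-mono-≤ {x′ = x′} {y = y} x≤x′ y≤y′ = ≤-trans (multinom-monoˡ-≤ y x≤x′) (multinom-monoʳ-≤ x′ y≤y′)

multinom-mono-< : ∀ {P Q p q} → P > 0 → P ≤ p → Q < q → multinom P Q < multinom p q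
multinom-mono-< {Q = Q} P>0 P≤p Q<q = <-≤-trans (multinom-<-sucʳ Q P>0) (multinom-mono-≤ P≤p Q<q)

multinom-growthˡ-step : ∀ {x p} y → suc x ≤ p → multinom x y * (p + y) ≤ multinom (suc x) y * p
multinom-growthˡ-step {x} {p} y sx≤p = *-cancelˡ-≤ (suc x) (begin
  suc x * (multinom x y * (p + y))
    ≡⟨ solve 4 (λ s f p y → s :* (f :* (p :+ y)) := f :* (s :* p :+ s :* y)) refl (suc x) (multinom x y) p y ⟩
  multinom x y * (suc x * p + suc x * y)
    ≤⟨ *-monoʳ-≤ (multinom x y) (+-monoʳ-≤ (suc x * p) (*-monoˡ-≤ y sx≤p)) ⟩
  multinom x y * (suc x * p + p * y)
    ≡⟨ solve 4 (λ s f p y → f :* (s :* p :+ p :* y) := (s :+ y) :* f :* p) refl (suc x) (multinom x y) p y ⟩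
  suc (x + y) * multinom x y * p
    ≡⟨ cong (_* p) (multinom-sucˡ x y) ⟨
  suc x * multinom (suc x) y * p
    ≡⟨ *-assoc (suc x) (multinom (suc x) y) p ⟩
  suc x * (multinom (suc x) y * p) ∎)
  where open ≤-Reasoning

multinom-growthˡ : ∀ {x p} y → x ≤ p → multinom x y * (p + y) ^ (p ∸ x) ≤ multinom p y * p ^ (p ∸ x)
multinom-growthˡ {x} {p} y x≤p =
  subst (λ z → multinom x y * (p + y) ^ (p ∸ x) ≤ multinom z y * p ^ (p ∸ x)) (m+[n∸m]≡n x≤p)
    (iterate (p ∸ x) (≤-reflexive (m+[n∸m]≡n x≤p)))
  where
  open ≤-Reasoning
  iterate : ∀ j → x + j ≤ p → multinom x y * (p + y) ^ j ≤ multinom (x + j) y * p ^ j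
  iterate zero    _ = ≤-reflexive (cong (λ z → multinom z y * 1) (sym (+-identityʳ x)))
  iterate (suc j) x+1+j≤p = begin
    multinom x y * ((p + y) * (p + y) ^ j)
      ≡⟨ x∙yz≈xz∙y (multinom x y) (p + y) ((p + y) ^ j) ⟩
    multinom x y * (p + y) ^ j * (p + y)
      ≤⟨ *-monoˡ-≤ (p + y) (iterate j (≤-trans (m≤n+m (x + j) 1) x+j+1≤p)) ⟩
    multinom (x + j) y * p ^ j * (p + y)
      ≡⟨ xy∙z≈xz∙y (multinom (x + j) y) (p ^ j) (p + y) ⟩
    multinom (x + j) y * (p + y) * p ^ j
      ≤⟨ *-monoˡ-≤ (p ^ j) (multinom-growthˡ-step y x+j+1≤p) ⟩
    multinom (suc (x + j)) y * p * p ^ j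
      ≡⟨ *-assoc (multinom (suc (x + j)) y) p (p ^ j) ⟩
    multinom (suc (x + j)) y * (p * p ^ j)
      ≡⟨ cong (λ z → multinom z y * (p * p ^ j)) (+-suc x j) ⟨
    multinom (x + suc j) y * (p * p ^ j) ∎
    where
    x+j+1≤p : suc (x + j) ≤ p
    x+j+1≤p = subst (_≤ p) (+-suc x j) x+1+j≤p

multinom-growthʳ : ∀ {x q} p → x ≤ q → multinom p x * (q + p) ^ (q ∸ x) ≤ multinom p q * q ^ (q ∸ x)
multinom-growthʳ {x} {q} p x≤q =
  subst₂ (λ u v → u * (q + p) ^ (q ∸ x) ≤ v * q ^ (q ∸ x)) (multinom-comm x p) (multinom-comm q p)
    (multinom-growthˡ p x≤q)

multinom-growth : ∀ {P Q p q} → P ≤ p → Q ≤ q →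
  multinom P Q * (p + Q) ^ (p ∸ P) * (q + p) ^ (q ∸ Q) ≤ multinom p q * p ^ (p ∸ P) * q ^ (q ∸ Q)
multinom-growth {P} {Q} {p} {q} P≤p Q≤q = begin
  multinom P Q * (p + Q) ^ j * (q + p) ^ k ≤⟨ *-monoˡ-≤ ((q + p) ^ k) (multinom-growthˡ Q P≤p) ⟩
  multinom p Q * p ^ j * (q + p) ^ k       ≡⟨ xy∙z≈xz∙y (multinom p Q) (p ^ j) ((q + p) ^ k) ⟩
  multinom p Q * (q + p) ^ k * p ^ j       ≤⟨ *-monoˡ-≤ (p ^ j) (multinom-growthʳ p Q≤q) ⟩
  multinom p q * q ^ k * p ^ j             ≡⟨ xy∙z≈xz∙y (multinom p q) (q ^ k) (p ^ j) ⟩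
  multinom p q * p ^ j * q ^ k             ∎
  where
  open ≤-Reasoning
  j = p ∸ P
  k = q ∸ Q

multinom-x0 : ∀ x → multinom x 0 ≡ 1
multinom-x0 x = *-cancelʳ-≡ _ _ (x ! * 1) {{x !* 0 !≢0}} (begin
  multinom x 0 * (x ! * 1) ≡⟨ multinom*!≡! x 0 ⟩
  (x + 0) !                ≡⟨ cong _! (+-identityʳ x) ⟩
  x !                      ≡⟨ *-identityʳ (x !) ⟨
  x ! * 1                  ≡⟨ *-identityˡ (x ! * 1) ⟨
  1 * (x ! * 1)            ∎)
  where open ≡-Reasoning

multinom-x1 : ∀ x → multinom x 1 ≡ suc x
multinom-x1 x = begin
  multinom x 1               ≡⟨ *-identityˡ (multinom x 1) ⟨
  1 * multinom x 1           ≡⟨ multinom-sucʳ x 0 ⟩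
  suc (x + 0) * multinom x 0 ≡⟨ cong₂ (λ u v → suc u * v) (+-identityʳ x) (multinom-x0 x) ⟩
  suc x * 1                  ≡⟨ *-identityʳ (suc x) ⟩
  suc x                      ∎
  where open ≡-Reasoning

multinom-double-sucʳ : ∀ x y → suc y * multinom (2 * x) (2 * suc y) ≡ suc (x + y) * multinom (2 * x) (suc (2 * y))
multinom-double-sucʳ x y = *-cancelˡ-≡ _ _ 2 (begin
  2 * (suc y * multinom (2 * x) (2 * suc y))
    ≡⟨ *-assoc 2 (suc y) _ ⟨
  2 * suc y * multinom (2 * x) (2 * suc y)
    ≡⟨ cong (λ z → z * multinom (2 * x) z) 2[1+y]≡2+2y ⟩
  suc (suc (2 * y)) * multinom (2 * x) (suc (suc (2 * y)))
    ≡⟨ multinom-sucʳ (2 * x) (suc (2 * y)) ⟩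
  suc (2 * x + suc (2 * y)) * multinom (2 * x) (suc (2 * y))
    ≡⟨ solve 3 (λ x y f → (con 1 :+ (con 2 :* x :+ (con 1 :+ con 2 :* y))) :* f := con 2 :* ((con 1 :+ (x :+ y)) :* f))
         refl x y (multinom (2 * x) (suc (2 * y))) ⟩
  2 * (suc (x + y) * multinom (2 * x) (suc (2 * y))) ∎)
  where
  open ≡-Reasoning
  2[1+y]≡2+2y : 2 * suc y ≡ suc (suc (2 * y))
  2[1+y]≡2+2y = *-suc 2 y

multinom-double-dominates : ∀ P Q → 2 * P * multinom P (suc Q) < multinom (2 * P) (2 * suc Q)
multinom-double-dominates P zero = *-cancelˡ-< 2 _ _ (begin-strict
  2 * (2 * P * multinom P 1)   ≡⟨ cong (λ z → 2 * (2 * P * z)) (multinom-x1 P) ⟩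
  2 * (2 * P * suc P)          ≡⟨ solve 1 (λ P → con 2 :* (con 2 :* P :* (con 1 :+ P)) := con 2 :* P :* (con 2 :+ con 2 :* P)) refl P ⟩
  2 * P * (2 + 2 * P)          <⟨ *-monoˡ-< (2 + 2 * P) (n<1+n (2 * P)) ⟩
  suc (2 * P) * (2 + 2 * P)    ≡⟨ solve 1 (λ P → (con 1 :+ con 2 :* P) :* (con 2 :+ con 2 :* P) := (con 2 :+ con 2 :* P) :* (con 1 :+ con 2 :* P)) refl P ⟩
  suc (suc (2 * P)) * suc (2 * P)   ≡⟨ cong₂ (λ u v → suc u * v) (+-comm (2 * P) 1) (multinom-x1 (2 * P)) ⟨
  suc (2 * P + 1) * multinom (2 * P) 1 ≡⟨ multinom-sucʳ (2 * P) 1 ⟨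
  2 * multinom (2 * P) 2       ∎)
  where open ≤-Reasoning
multinom-double-dominates P (suc Q) = *-cancelˡ-< (suc (suc Q)) _ _ (begin-strict
  suc (suc Q) * (2 * P * multinom P (suc (suc Q))) ≡⟨ x∙yz≈y∙xz (suc (suc Q)) (2 * P) _ ⟩
  2 * P * (suc (suc Q) * multinom P (suc (suc Q))) ≡⟨ cong (2 * P *_) (multinom-sucʳ P (suc Q)) ⟩
  2 * P * (S * multinom P (suc Q))                 ≡⟨ x∙yz≈y∙xz (2 * P) S _ ⟩
  S * (2 * P * multinom P (suc Q))                 <⟨ *-monoʳ-< S (multinom-double-dominates P Q) ⟩
  S * multinom (2 * P) (2 * suc Q)                 ≤⟨ *-monoʳ-≤ S (multinom-monoʳ-≤ (2 * P) (n≤1+n (2 * suc Q))) ⟩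
  S * multinom (2 * P) (suc (2 * suc Q))           ≡⟨ multinom-double-sucʳ P (suc Q) ⟨
  suc (suc Q) * multinom (2 * P) (2 * suc (suc Q)) ∎)
  where
  open ≤-Reasoning
  S = suc (P + suc Q)

multinom-sucˡ-ratio : ∀ {x y} → x > 0 → y ≥ 2 → suc x * multinom x y ≤ x * multinom (suc x) y
multinom-sucˡ-ratio {x@(suc x′)} {y@(suc (suc y′))} z<s (s<s z<s) = *-cancelˡ-≤ (suc x) (begin
  suc x * (suc x * multinom x y) ≡⟨ *-assoc (suc x) (suc x) (multinom x y) ⟨
  suc x * suc x * multinom x y   ≤⟨ *-monoˡ-≤ (multinom x y) [1+x]²≤x[1+x+y] ⟩
  x * suc (x + y) * multinom x y ≡⟨ *-assoc x (suc (x + y)) (multinom x y) ⟩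
  x * (suc (x + y) * multinom x y) ≡⟨ cong (x *_) (multinom-sucˡ x y) ⟨
  x * (suc x * multinom (suc x) y) ≡⟨ x∙yz≈y∙xz x (suc x) (multinom (suc x) y) ⟩
  suc x * (x * multinom (suc x) y) ∎)
  where
  open ≤-Reasoning
  -- x (x + 1 + y) − (x + 1)² = x y − x − 1 = x′ + y′ + x′ y′.
  [1+x]²≤x[1+x+y] : suc x * suc x ≤ x * suc (x + y)
  [1+x]²≤x[1+x+y] = begin
    suc x * suc x                          ≤⟨ m≤m+n (suc x * suc x) (x′ + y′ + x′ * y′) ⟩
    suc x * suc x + (x′ + y′ + x′ * y′)    ≡⟨ solve 2 (λ a b → (con 2 :+ a) :* (con 2 :+ a) :+ (a :+ b :+ a :* b)
                                                 := (con 1 :+ a) :* (con 1 :+ ((con 1 :+ a) :+ (con 2 :+ b)))) refl x′ y′ ⟩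
    x * suc (x + y)                        ∎

multinom-dominates : ∀ {P Q p q} → P > 0 → Q > 0 → 2 * P ≤ p → 2 * Q ≤ q → p * multinom P Q < multinom p q
multinom-dominates {P@(suc _)} {suc Q′} {p} {q} z<s z<s 2P≤p 2Q≤q = lift (≤⇒≤′ 2P≤p)
  where
  open ≤-Reasoning
  B = multinom P (suc Q′)
  q≥2 : q ≥ 2
  q≥2 = ≤-trans (*-monoʳ-≤ 2 (s≤s z≤n)) 2Q≤q
  lift : ∀ {x} → 2 * P ≤′ x → x * B < multinom x q
  lift ≤′-refl = <-≤-trans (multinom-double-dominates P Q′) (multinom-monoʳ-≤ (2 * P) 2Q≤q)
  lift {suc x} (≤′-step 2P≤′x) = *-cancelˡ-< x _ _ (begin-strict
    x * (suc x * B)        ≡⟨ x∙yz≈y∙xz x (suc x) B ⟩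
    suc x * (x * B)        <⟨ *-monoʳ-< (suc x) (lift 2P≤′x) ⟩
    suc x * multinom x q   ≤⟨ multinom-sucˡ-ratio (<-≤-trans z<s (≤′⇒≤ 2P≤′x)) q≥2 ⟩
    x * multinom (suc x) q ∎)

-- Arithmetic in ℚᵘ does not normalise, so a representative built from fractions x / d by + and * has
-- the corresponding ℕ expressions as numerator and denominator.
record _/_≅_ (x d : ℕ) (q : ℚ) : Set where
  constructor fraction
  field
    repr      : ℚᵘ
    toℚᵘ≃repr : toℚᵘ q ℚᵘ.≃ repr
    ↥repr     : ↥ repr ≡ + x
    ↧repr     : ↧ₙ repr ≡ d

/-fraction : ∀ x d .{{_ : NonZero d}} → x / d ≅ ((+ x) ℚ./ d)
/-fraction x (suc d) = fraction ((+ x) ℚᵘ./ suc d) (toℚᵘ-fromℚᵘ (mkℚᵘ (+ x) d)) refl refl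

1-fraction : 1 / 1 ≅ ℚ.1ℚ
1-fraction = fraction ℚᵘ.1ℚᵘ ℚᵘₚ.≃-refl refl refl

+-fraction : ∀ {x d y e p q} → x / d ≅ p → y / e ≅ q → (x * e + y * d) / (d * e) ≅ (p ℚ.+ q)
+-fraction {x} {d} {y} {e} {p} {q} (fraction r@(mkℚᵘ _ _) p≃r refl refl) (fraction s@(mkℚᵘ _ _) q≃s refl refl) =
  fraction (r ℚᵘ.+ s) (ℚᵘₚ.≃-trans (toℚᵘ-homo-+ p q) (ℚᵘₚ.+-cong p≃r q≃s))
    (trans (cong₂ ℤ._+_ (sym (pos-* x e)) (sym (pos-* y d))) (sym (pos-+ (x * e) (y * d)))) refl

*-fraction : ∀ {x d y e p q} → x / d ≅ p → y / e ≅ q → (x * y) / (d * e) ≅ (p ℚ.* q)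
*-fraction {x} {y = y} {p = p} {q} (fraction r@(mkℚᵘ _ _) p≃r refl refl) (fraction s@(mkℚᵘ _ _) q≃s refl refl) =
  fraction (r ℚᵘ.* s) (ℚᵘₚ.≃-trans (toℚᵘ-homo-* p q) (ℚᵘₚ.*-cong p≃r q≃s)) (sym (pos-* x y)) refl

^-fraction : ∀ {x d p} k → x / d ≅ p → (x ^ k) / (d ^ k) ≅ (p ^ℚ k)
^-fraction zero    _   = 1-fraction
^-fraction (suc k) x/d = *-fraction x/d (^-fraction k x/d)

≅-≤ : ∀ {x d y e p q} → x / d ≅ p → y / e ≅ q → x * e ≤ y * d → p ℚ.≤ q
≅-≤ {x} {d} {y} {e} (fraction r@(mkℚᵘ _ _) p≃r refl refl) (fraction s@(mkℚᵘ _ _) q≃s refl refl) xe≤yd =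
  toℚᵘ-cancel-≤ (ℚᵘₚ.≤-respˡ-≃ (ℚᵘₚ.≃-sym p≃r) (ℚᵘₚ.≤-respʳ-≃ (ℚᵘₚ.≃-sym q≃s)
    (*≤* (subst₂ ℤ._≤_ (pos-* x e) (pos-* y d) (+≤+ xe≤yd)))))

onePlusFrac-fraction : ∀ m n .{{_ : NonZero n}} → (n + m) / n ≅ onePlusFrac m n
onePlusFrac-fraction m n = subst₂ (λ u v → u / v ≅ onePlusFrac m n)
  (cong₂ _+_ (*-identityˡ n) (*-identityʳ m)) (*-identityˡ n) (+-fraction 1-fraction (/-fraction m n))

onePlusFrac2-fraction : ∀ a b n m .{{_ : NonZero b}} .{{_ : NonZero m}} → (b * m + a * n) / (b * m) ≅ onePlusFrac2 a b n m
onePlusFrac2-fraction a b n m = subst₂ (λ u v → u / v ≅ onePlusFrac2 a b n m)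
  (cong₂ _+_ (*-identityˡ (b * m)) (*-identityʳ (a * n))) (*-identityˡ (b * m)) (+-fraction 1-fraction (/-fraction (a * n) (b * m)))
  where instance _ = m*n≢0 b m

onePlusFrac-^-bound : ∀ m n a b k j B A .{{_ : NonZero n}} .{{_ : NonZero b}} .{{_ : NonZero m}} →
  (n + m) ^ k * (b * m + a * n) ^ j * B ≤ A * (n ^ k * (b * m) ^ j) →
  ((onePlusFrac m n ^ℚ k) ℚ.* (onePlusFrac2 a b n m ^ℚ j)) ℚ.* ℕtoℚ B ℚ.≤ ℕtoℚ A
onePlusFrac-^-bound m n a b k j B A le = ≅-≤
  (*-fraction (*-fraction (^-fraction k (onePlusFrac-fraction m n)) (^-fraction j (onePlusFrac2-fraction a b n m))) (/-fraction B 1))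
  (/-fraction A 1)
  (subst₂ _≤_ (sym (*-identityʳ _)) (cong (A *_) (sym (*-identityʳ _))) le)

^-distribʳ-* : ∀ x y k → (x * y) ^ k ≡ x ^ k * y ^ k
^-distribʳ-* x y zero    = refl
^-distribʳ-* x y (suc k) = trans (cong (x * y *_) (^-distribʳ-* x y k)) (interchange x y (x ^ k) (y ^ k))

multinom-quotient-ratio : ∀ {m n a b p q P Q} .{{_ : NonZero m}} .{{_ : NonZero n}} .{{_ : NonZero b}} →
  p * a ≡ m → q * a ≡ n → Q * b ≡ n → P ≤ p → Q ≤ q →
  ((onePlusFrac m n ^ℚ (q ∸ Q)) ℚ.* (onePlusFrac2 a b n m ^ℚ (p ∸ P))) ℚ.* ℕtoℚ (multinom P Q) ℚ.≤ ℕtoℚ (multinom p q)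
multinom-quotient-ratio {m} {n} {a} {b} {p} {q} {P} {Q} pa≡m qa≡n Qb≡n P≤p Q≤q =
  onePlusFrac-^-bound m n a b k j B A (begin
    (n + m) ^ k * (b * m + a * n) ^ j * B
      ≡⟨ cong₂ (λ u v → u ^ k * v ^ j * B) n+m≡[q+p]a bm+an≡[p+Q]ab ⟩
    ((q + p) * a) ^ k * ((p + Q) * (a * b)) ^ j * B
      ≡⟨ cong₂ (λ u v → u * v * B) (^-distribʳ-* (q + p) a k) (^-distribʳ-* (p + Q) (a * b) j) ⟩
    (q + p) ^ k * a ^ k * ((p + Q) ^ j * (a * b) ^ j) * B
      ≡⟨ solve 5 (λ u v w x y → u :* v :* (w :* x) :* y := v :* x :* (y :* w :* u)) refl
           ((q + p) ^ k) (a ^ k) ((p + Q) ^ j) ((a * b) ^ j) B ⟩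
    a ^ k * (a * b) ^ j * (B * (p + Q) ^ j * (q + p) ^ k)
      ≤⟨ *-monoʳ-≤ (a ^ k * (a * b) ^ j) (multinom-growth P≤p Q≤q) ⟩
    a ^ k * (a * b) ^ j * (A * p ^ j * q ^ k)
      ≡⟨ solve 5 (λ u v w x y → u :* v :* (w :* x :* y) := w :* (y :* u :* (x :* v))) refl
           (a ^ k) ((a * b) ^ j) A (p ^ j) (q ^ k) ⟩
    A * (q ^ k * a ^ k * (p ^ j * (a * b) ^ j))
      ≡⟨ cong₂ (λ u v → A * (u * v)) (^-distribʳ-* q a k) (^-distribʳ-* p (a * b) j) ⟨
    A * ((q * a) ^ k * (p * (a * b)) ^ j)
      ≡⟨ cong₂ (λ u v → A * (u ^ k * v ^ j)) qa≡n p[ab]≡bm ⟩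
    A * (n ^ k * (b * m) ^ j) ∎)
  where
  open ≤-Reasoning
  k = q ∸ Q
  j = p ∸ P
  A = multinom p q
  B = multinom P Q
  n+m≡[q+p]a : n + m ≡ (q + p) * a
  n+m≡[q+p]a = sym (trans (*-distribʳ-+ a q p) (cong₂ _+_ qa≡n pa≡m))
  p[ab]≡bm : p * (a * b) ≡ b * m
  p[ab]≡bm = trans (solve 3 (λ p a b → p :* (a :* b) := b :* (p :* a)) refl p a b) (cong (b *_) pa≡m)
  bm+an≡[p+Q]ab : b * m + a * n ≡ (p + Q) * (a * b)
  bm+an≡[p+Q]ab = begin-equality
    b * m + a * n             ≡⟨ cong₂ _+_ p[ab]≡bm (cong (a *_) Qb≡n) ⟨
    p * (a * b) + a * (Q * b) ≡⟨ solve 4 (λ p Q a b → p :* (a :* b) :+ a :* (Q :* b) := (p :+ Q) :* (a :* b)) refl p Q a b ⟩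
    (p + Q) * (a * b)         ∎

quotient>0 : ∀ {P b m} .{{_ : NonZero m}} → P * b ≡ m → P > 0
quotient>0 {zero}  {m = m} Pb≡m = contradiction (sym Pb≡m) (≢-nonZero⁻¹ m)
quotient>0 {suc P} _            = z<s

quotient-< : ∀ {P p a b} → P * b ≡ p * a → P > 0 → a < b → P < p
quotient-< {P} {p} {a} {b} Pb≡pa P>0 a<b = *-cancelʳ-< a P p (begin-strict
  P * a <⟨ *-monoʳ-< P {{>-nonZero P>0}} a<b ⟩
  P * b ≡⟨ Pb≡pa ⟩
  p * a ∎)
  where open ≤-Reasoning

quotient-double : ∀ {P p a b} .{{_ : NonZero a}} → P * b ≡ p * a → 2 * a ≤ b → 2 * P ≤ p
quotient-double {P} {p} {a} {b} Pb≡pa 2a≤b = *-cancelʳ-≤ (2 * P) p a (begin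
  2 * P * a   ≡⟨ xy∙z≈y∙xz 2 P a ⟩
  P * (2 * a) ≤⟨ *-monoʳ-≤ P 2a≤b ⟩
  P * b       ≡⟨ Pb≡pa ⟩
  p * a       ∎)
  where open ≤-Reasoning

⊔-*-multinom<*-multinom : ∀ {m n a p q P Q} .{{_ : NonZero a}} → p * a ≡ m → q * a ≡ n →
  P > 0 → Q > 0 → 2 * P ≤ p → 2 * Q ≤ q → (m ⊔ n) * multinom P Q < a * multinom p q
⊔-*-multinom<*-multinom {m} {n} {a} {p} {q} {P} {Q} pa≡m qa≡n P>0 Q>0 2P≤p 2Q≤q = begin-strict
  (m ⊔ n) * B     ≡⟨ cong (_* B) (trans (*-distribʳ-⊔ a p q) (cong₂ _⊔_ pa≡m qa≡n)) ⟨
  (p ⊔ q) * a * B ≡⟨ xy∙z≈y∙xz (p ⊔ q) a B ⟩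
  a * ((p ⊔ q) * B) ≡⟨ cong (a *_) (*-distribʳ-⊔ B p q) ⟩
  a * (p * B ⊔ q * B) <⟨ *-monoʳ-< a (⊔-lub pB<A qB<A) ⟩
  a * A           ∎
  where
  open ≤-Reasoning
  A = multinom p q
  B = multinom P Q
  pB<A : p * B < A
  pB<A = multinom-dominates P>0 Q>0 2P≤p 2Q≤q
  qB<A : q * B < A
  qB<A = subst₂ (λ u v → q * u < v) (multinom-comm Q P) (multinom-comm q p) (multinom-dominates Q>0 P>0 2Q≤q 2P≤p)

lemma2p1 : (m n a b : ℕ) .{{_ : NonZero m}} .{{_ : NonZero n}} .{{_ : NonZero a}} .{{_ : NonZero b}}
    → 2 ≤ m → 2 ≤ n → 2 ≤ a → 2 ≤ b
    → a ∣ gcd m n → b ∣ gcd m n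
    → (a < b
        → (((onePlusFrac m n ^ℚ ((n / a) ∸ (n / b)))
              ℚ.* (onePlusFrac2 a b n m ^ℚ ((m / a) ∸ (m / b))))
              ℚ.* ℕtoℚ (multinom (m / b) (n / b))
            ℚ.≤ ℕtoℚ (multinom (m / a) (n / a)))
          × (multinom (m / b) (n / b) < multinom (m / a) (n / a)))
    × (2 * a ≤ b
        → (m ⊔ n) * multinom (m / b) (n / b) < a * multinom (m / a) (n / a))
lemma2p1 m n a b _ _ _ _ a∣gcd b∣gcd =
  (λ a<b → multinom-quotient-ratio pa≡m qa≡n Qb≡n (<⇒≤ (P<p a<b)) (<⇒≤ (Q<q a<b))
         , multinom-mono-< P>0 (<⇒≤ (P<p a<b)) (Q<q a<b))
  , λ 2a≤b → ⊔-*-multinom<*-multinom {p = p} {q} {P} {Q} pa≡m qa≡n P>0 Q>0 (2P≤p 2a≤b) (2Q≤q 2a≤b)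
  where
  p = m / a
  q = n / a
  P = m / b
  Q = n / b
  pa≡m : p * a ≡ m
  pa≡m = m/n*n≡m (∣-trans a∣gcd (gcd[m,n]∣m m n))
  qa≡n : q * a ≡ n
  qa≡n = m/n*n≡m (∣-trans a∣gcd (gcd[m,n]∣n m n))
  Pb≡m : P * b ≡ m
  Pb≡m = m/n*n≡m (∣-trans b∣gcd (gcd[m,n]∣m m n))
  Qb≡n : Q * b ≡ n
  Qb≡n = m/n*n≡m (∣-trans b∣gcd (gcd[m,n]∣n m n))
  P>0 : P > 0
  P>0 = quotient>0 Pb≡m
  Q>0 : Q > 0
  Q>0 = quotient>0 Qb≡n
  P<p : a < b → P < p
  P<p = quotient-< (trans Pb≡m (sym pa≡m)) P>0
  Q<q : a < b → Q < q
  Q<q = quotient-< (trans Qb≡n (sym qa≡n)) Q>0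
  2P≤p : 2 * a ≤ b → 2 * P ≤ p
  2P≤p = quotient-double {P} {p} (trans Pb≡m (sym pa≡m))
  2Q≤q : 2 * a ≤ b → 2 * Q ≤ q
  2Q≤q = quotient-double {Q} {q} (trans Qb≡n (sym qa≡n))
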